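{- Let $n\geqslant 1$ and let $[N']$ be a conjugacy $(n+1)$-class (an orbit of $\mathbf{U}^*_{n+1}$ acting by conjugation on nilpotent upper-triangular $(n+1)\times(n+1)$ matrices over $\mathbb{F}_q$) which is trivially extended, i.e. $[N']$ contains a matrix whose last column is zero. Then the matrix degree of $[N']$ equals $1$.
   Context: $\mathbb{F}_q$ is the finite field with $q$ elements. $\mathbf{U}^*_k$ denotes the group of invertible upper-triangular $k\times k$ matrices over $\mathbb{F}_q$ and $\mathbf{U}^o_k$ the set of nilpotent upper-triangular $k\times k$ matrices over $\mathbb{F}_q$; $\mathbf{U}^*_k$ acts on $\mathbf{U}^o_k$ by $B.N=B^{ -1}NB$, and an orbit is a conjugacy $k$-class. For $N'\in\mathbf{U}^o_{n+1}$ let $p(N')\in\mathbf{U}^o_n$ be its top-left $n\times n$ block; the parent class of $[N']$ is $[p(N')]$ (well defined). Let $\mathbf{U}^!_{n+1}\subset \mathbf{U}^*_{n+1}$ be the subgroup of matrices $\begin{pmatrix} I_n & b\\ 0 & k\end{pmatrix}$ with $b\in\mathbb{F}_q^{n\times 1}$, $k\in\mathbb{F}_q^*$. Matrix degree: for a conjugacy $(n+1)$-class $[N']$ with parent $[N]$, set $B(N;[N'])=\left\{\begin{pmatrix}N&b\\0&0\end{pmatrix}: b\in\mathbb{F}_q^{n\times1}\right\}\cap[N']$; the matrix degree of $[N']$ is the number of orbits of $\mathbf{U}^!_{n+1}$ acting by conjugation on $B(N;[N'])$ (this number does not depend on the choice of $N$ in $[N]$). -}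

module Defs where

open import Level using (Level; _⊔_)
open import Data.Nat using (ℕ; zero; suc)
open import Data.Fin using (Fin; zero; suc; inject₁; fromℕ)
open import Data.Maybe using (Maybe; just; nothing)
import Data.Maybe as Maybe
open import Data.List using (List)
open import Data.List.Relation.Unary.Any using (Any)
open import Data.Product using (Σ; ∃; _×_; _,_)
open import Relation.Nullary using (¬_)
open import Algebra.Bundles using (CommutativeRing)

record Field (c ℓ : Level) : Set (Level.suc (c ⊔ ℓ)) where
  field
    commutativeRing : CommutativeRing c ℓ
  open CommutativeRing commutativeRing public
  field
    0≉1 : ¬ (0# ≈ 1#)
    inverse : ∀ x → ¬ (x ≈ 0#) → Σ Carrier λ y → (x * y) ≈ 1#

record FiniteField (c ℓ : Level) : Set (Level.suc (c ⊔ ℓ)) where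
  field
    field′ : Field c ℓ
  open Field field′ public
  field
    elements : List Carrier
    complete : ∀ x → Any (λ y → x ≈ y) elements

module Matrices {c ℓ : Level} (F : FiniteField c ℓ) where
  open FiniteField F using (Carrier; _≈_; _+_; _*_; 0#; 1#)
  open import Data.Fin using (toℕ)
  open import Data.Nat using (_<_; _≤_)

  Mat : ℕ → Set c
  Mat k = Fin k → Fin k → Carrier

  _≈M_ : ∀ {k} → Mat k → Mat k → Set ℓ
  A ≈M B = ∀ i j → A i j ≈ B i j

  sumFin : ∀ {k} → (Fin k → Carrier) → Carrier
  sumFin {zero} f = 0#
  sumFin {suc k} f = f zero + sumFin (λ i → f (suc i))

  _·_ : ∀ {k} → Mat k → Mat k → Mat k
  (A · B) i j = sumFin (λ l → A i l * B l j)

  idM : ∀ {k} → Mat k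
  idM {suc k} zero zero = 1#
  idM {suc k} zero (suc j) = 0#
  idM {suc k} (suc i) zero = 0#
  idM {suc k} (suc i) (suc j) = idM {k} i j

  zeroM : ∀ {k} → Mat k
  zeroM i j = 0#

  _^_ : ∀ {k} → Mat k → ℕ → Mat k
  A ^ zero = idM
  A ^ suc m = A · (A ^ m)

  UpperTriangular : ∀ {k} → Mat k → Set ℓ
  UpperTriangular A = ∀ i j → toℕ j < toℕ i → A i j ≈ 0#

  Nilpotent : ∀ {k} → Mat k → Set ℓ
  Nilpotent A = ∃ λ m → (A ^ m) ≈M zeroM

  UNil : ∀ {k} → Mat k → Set ℓ
  UNil A = UpperTriangular A × Nilpotent A

  IsInverse : ∀ {k} → Mat k → Mat k → Set ℓ
  IsInverse B B′ = ((B · B′) ≈M idM) × ((B′ · B) ≈M idM)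

  _∼_ : ∀ {k} → Mat k → Mat k → Set (c ⊔ ℓ)
  _∼_ {k} N₁ N₂ = Σ (Mat k) λ B → Σ (Mat k) λ B′ →
    UpperTriangular B × IsInverse B B′ × ((B′ · N₁) · B) ≈M N₂

  -- classify an index of Fin (suc n): just i for the first n indices, nothing for the last
  inner? : ∀ {n} → Fin (suc n) → Maybe (Fin n)
  inner? {zero} zero = nothing
  inner? {suc n} zero = just zero
  inner? {suc n} (suc i) = Maybe.map suc (inner? i)

  parent : ∀ {n} → Mat (suc n) → Mat n
  parent N′ i j = N′ (inject₁ i) (inject₁ j)

  -- the block matrix ( N b ; 0 0 )
  extend : ∀ {n} → Mat n → (Fin n → Carrier) → Mat (suc n)
  extend N b i j with inner? i | inner? j
  ... | just i′ | just j′ = N i′ j′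
  ... | just i′ | nothing = b i′
  ... | nothing | _ = 0#

  -- the element ( I_n b ; 0 k ) of U^!_{n+1}
  bang : ∀ {n} → (Fin n → Carrier) → Carrier → Mat (suc n)
  bang b k i j with inner? i | inner? j
  ... | just i′ | just j′ = idM i′ j′
  ... | just i′ | nothing = b i′
  ... | nothing | just _ = 0#
  ... | nothing | nothing = k

  SameBangOrbit : ∀ {n} → Mat (suc n) → Mat (suc n) → Set (c ⊔ ℓ)
  SameBangOrbit {n} M₁ M₂ = Σ (Fin n → Carrier) λ b → Σ Carrier λ k → Σ (Mat (suc n)) λ g′ →
    ¬ (k ≈ 0#) × IsInverse (bang b k) g′ × ((g′ · M₁) · bang b k) ≈M M₂

  -- membership in B(N;[N′]) (as the column b)
  InB : ∀ {n} → Mat n → Mat (suc n) → (Fin n → Carrier) → Set (c ⊔ ℓ)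
  InB N N′ b = extend N b ∼ N′

  -- the U^!_{n+1}-action on B(N;[N′]) has exactly one orbit:
  -- B(N;[N′]) is nonempty and any two of its elements are in the same orbit
  MatrixDegreeOne : ∀ {n} → Mat n → Mat (suc n) → Set (c ⊔ ℓ)
  MatrixDegreeOne {n} N N′ =
    (Σ (Fin n → Carrier) λ b → InB N N′ b) ×
    (∀ b₁ b₂ → InB N N′ b₁ → InB N N′ b₂ → SameBangOrbit (extend N b₁) (extend N b₂))

  TriviallyExtended : ∀ {n} → Mat (suc n) → Set (c ⊔ ℓ)
  TriviallyExtended {n} N′ = Σ (Mat (suc n)) λ M → (M ∼ N′) × (∀ i → M i (fromℕ n) ≈ 0#)

{-# OPTIONS --safe #-}
-- A trivially extended class contains ( M 0 ; 0 0 ) with M ∼ N, so ( N 0 ; 0 0 ) lies in B(N;[N′]).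
-- If H = ( A h ; 0 k ) ∈ U* conjugates ( N 0 ; 0 0 ) to ( N b ; 0 0 ), comparing blocks gives
-- A⁻¹NA = N and b = A⁻¹N h; hence A⁻¹ commutes with N and b = N (A⁻¹ h) is in the column space of N.
-- Finally ( I x₂ − x₁ ; 0 1 ) ∈ U^! conjugates ( N Nx₁ ; 0 0 ) to ( N Nx₂ ; 0 0 ).
module Submission where

open import Defs
open import Level using (Level)
open import Data.Nat using (ℕ; suc; _≥_)
import Data.Nat as ℕ
open import Data.Nat.Properties using (<-asym; <-irrefl; <-≤-trans; ≮⇒≥)
open import Data.Fin using (Fin; zero; suc; inject₁; fromℕ; toℕ)
open import Data.Fin.Properties using (toℕ-inject₁; toℕ-fromℕ; toℕ<n)
open import Data.Fin.Relation.Unary.Top using (view; ‵fromℕ; ‵inject₁)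
open import Data.Maybe using (just; nothing)
open import Data.Product using (Σ; _,_; _×_; proj₁; proj₂)
open import Data.Vec.Functional using (Vector)
open import Data.Empty using (⊥-elim)
open import Relation.Nullary using (yes; no)
open import Relation.Binary.Bundles using (Setoid)
open import Relation.Binary.PropositionalEquality as ≡ using (_≡_)
import Relation.Binary.Reasoning.Setoid as SetoidReasoning

module MatrixDegree {c ℓ : Level} (F : FiniteField c ℓ) where
  open FiniteField F hiding (zero)
  open Matrices F
  open import Algebra.Properties.Semiring.Sum semiring
    using (sum; sum-cong-≋; sum-replicate-zero; sum-init-last; ∑-distrib-+; ∑-comm; *-distribˡ-sum; *-distribʳ-sum)
  open import Data.Vec.Functional.Relation.Binary.Equality.Setoid setoid
    using (_≋_; ≋-refl; ≋-sym; ≋-trans)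
  module ≈-Reasoning = SetoidReasoning setoid

  sumFin≡sum : ∀ {k} (f : Vector Carrier k) → sumFin f ≡ sum f
  sumFin≡sum {ℕ.zero} f = ≡.refl
  sumFin≡sum {suc k} f = ≡.cong (f zero +_) (sumFin≡sum (λ i → f (suc i)))

  sumFin≈sum : ∀ {k} (f : Vector Carrier k) → sumFin f ≈ sum f
  sumFin≈sum f = reflexive (sumFin≡sum f)

  sumFin-cong : ∀ {k} {f g : Vector Carrier k} → f ≋ g → sumFin f ≈ sumFin g
  sumFin-cong {f = f} {g} f≋g = trans (sumFin≈sum f) (trans (sum-cong-≋ f≋g) (sym (sumFin≈sum g)))

  sumFin-zero : ∀ {k} {f : Vector Carrier k} → f ≋ (λ _ → 0#) → sumFin f ≈ 0#
  sumFin-zero {k} f≋0 =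
    trans (sumFin-cong {k} f≋0) (trans (sumFin≈sum {k} (λ _ → 0#)) (sum-replicate-zero k))

  sumFin-distrib-+ : ∀ {k} (f g : Vector Carrier k) →
    sumFin (λ i → f i + g i) ≈ sumFin f + sumFin g
  sumFin-distrib-+ f g = trans (sumFin≈sum (λ i → f i + g i))
    (trans (∑-distrib-+ f g) (sym (+-cong (sumFin≈sum f) (sumFin≈sum g))))

  *-distribˡ-sumFin : ∀ {k} x (f : Vector Carrier k) → x * sumFin f ≈ sumFin (λ i → x * f i)
  *-distribˡ-sumFin x f =
    trans (*-congˡ (sumFin≈sum f)) (trans (*-distribˡ-sum x f) (sym (sumFin≈sum (λ i → x * f i))))

  *-distribʳ-sumFin : ∀ {k} x (f : Vector Carrier k) → sumFin f * x ≈ sumFin (λ i → f i * x)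
  *-distribʳ-sumFin x f =
    trans (*-congʳ (sumFin≈sum f)) (trans (*-distribʳ-sum x f) (sym (sumFin≈sum (λ i → f i * x))))

  sumFin-comm : ∀ {m n} (f : Fin m → Fin n → Carrier) →
    sumFin (λ i → sumFin (λ j → f i j)) ≈ sumFin (λ j → sumFin (λ i → f i j))
  sumFin-comm {m} {n} f = begin
    sumFin (λ i → sumFin (λ j → f i j)) ≈⟨ sumFin-cong {m} (λ i → sumFin≈sum (f i)) ⟩
    sumFin (λ i → sum (λ j → f i j))    ≈⟨ sumFin≈sum (λ i → sum (f i)) ⟩
    sum (λ i → sum (λ j → f i j))       ≈⟨ ∑-comm f ⟩
    sum (λ j → sum (λ i → f i j))       ≈⟨ sumFin≈sum (λ j → sum (λ i → f i j)) ⟨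
    sumFin (λ j → sum (λ i → f i j))    ≈⟨ sumFin-cong {n} (λ j → sumFin≈sum (λ i → f i j)) ⟨
    sumFin (λ j → sumFin (λ i → f i j)) ∎
    where open ≈-Reasoning

  sumFin-init-last : ∀ {n} (f : Vector Carrier (suc n)) →
    sumFin f ≈ sumFin (λ i → f (inject₁ i)) + f (fromℕ n)
  sumFin-init-last f =
    trans (sumFin≈sum f) (trans (sum-init-last f) (+-congʳ (sym (sumFin≈sum (λ i → f (inject₁ i))))))

  infixr 7 _·ᵥ_
  _·ᵥ_ : ∀ {k} → Mat k → Vector Carrier k → Vector Carrier k
  (A ·ᵥ v) i = sumFin (λ l → A i l * v l)

  0ᵥ : ∀ {k} → Vector Carrier k
  0ᵥ _ = 0#

  ·ᵥ-cong : ∀ {k} {A A′ : Mat k} {v w : Vector Carrier k} → A ≈M A′ → v ≋ w → A ·ᵥ v ≋ A′ ·ᵥ w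
  ·ᵥ-cong {k} A≈A′ v≋w i = sumFin-cong {k} (λ l → *-cong (A≈A′ i l) (v≋w l))

  ·ᵥ-zeroʳ : ∀ {k} (A : Mat k) → A ·ᵥ 0ᵥ ≋ 0ᵥ
  ·ᵥ-zeroʳ {k} A i = sumFin-zero {k} (λ l → zeroʳ (A i l))

  ·ᵥ-distrib-+ : ∀ {k} (A : Mat k) (v w : Vector Carrier k) →
    A ·ᵥ (λ l → v l + w l) ≋ (λ i → (A ·ᵥ v) i + (A ·ᵥ w) i)
  ·ᵥ-distrib-+ {k} A v w i = trans (sumFin-cong {k} (λ l → distribˡ (A i l) (v l) (w l)))
    (sumFin-distrib-+ (λ l → A i l * v l) (λ l → A i l * w l))

  ·ᵥ-assoc : ∀ {k} (A B : Mat k) (v : Vector Carrier k) → (A · B) ·ᵥ v ≋ A ·ᵥ (B ·ᵥ v)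
  ·ᵥ-assoc {k} A B v i = begin
    sumFin (λ m → sumFin (λ l → A i l * B l m) * v m)
      ≈⟨ sumFin-cong {k} (λ m → *-distribʳ-sumFin (v m) (λ l → A i l * B l m)) ⟩
    sumFin (λ m → sumFin (λ l → (A i l * B l m) * v m))
      ≈⟨ sumFin-comm (λ m l → (A i l * B l m) * v m) ⟩
    sumFin (λ l → sumFin (λ m → (A i l * B l m) * v m))
      ≈⟨ sumFin-cong {k} (λ l → sumFin-cong {k} (λ m → *-assoc (A i l) (B l m) (v m))) ⟩
    sumFin (λ l → sumFin (λ m → A i l * (B l m * v m)))
      ≈⟨ sumFin-cong {k} (λ l → *-distribˡ-sumFin (A i l) (λ m → B l m * v m)) ⟨
    sumFin (λ l → A i l * sumFin (λ m → B l m * v m))   ∎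
    where open ≈-Reasoning

  ·ᵥ-identityˡ : ∀ {k} (v : Vector Carrier k) → idM ·ᵥ v ≋ v
  ·ᵥ-identityˡ {suc k} v zero =
    trans (+-cong (*-identityˡ (v zero)) (sumFin-zero {k} (λ l → zeroˡ (v (suc l))))) (+-identityʳ _)
  ·ᵥ-identityˡ {suc k} v (suc i) =
    trans (+-cong (zeroˡ (v zero)) (·ᵥ-identityˡ (λ l → v (suc l)) i)) (+-identityˡ _)

  sum-*-idM : ∀ {k} (v : Vector Carrier k) j → sumFin (λ l → v l * idM l j) ≈ v j
  sum-*-idM {suc k} v zero =
    trans (+-cong (*-identityʳ (v zero)) (sumFin-zero {k} (λ l → zeroʳ (v (suc l))))) (+-identityʳ _)
  sum-*-idM {suc k} v (suc j) =
    trans (+-cong (zeroʳ (v zero)) (sum-*-idM (λ l → v (suc l)) j)) (+-identityˡ _)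

  ≈M-setoid : ℕ → Setoid c ℓ
  ≈M-setoid k = record
    { Carrier = Mat k
    ; _≈_ = _≈M_
    ; isEquivalence = record
      { refl = λ i j → refl
      ; sym = λ A≈B i j → sym (A≈B i j)
      ; trans = λ A≈B B≈C i j → trans (A≈B i j) (B≈C i j)
      }
    }

  module ≈M {k : ℕ} = Setoid (≈M-setoid k)
  module ≈M-Reasoning {k : ℕ} = SetoidReasoning (≈M-setoid k)

  ·-cong : ∀ {k} {A A′ B B′ : Mat k} → A ≈M A′ → B ≈M B′ → (A · B) ≈M (A′ · B′)
  ·-cong A≈A′ B≈B′ i j = ·ᵥ-cong A≈A′ (λ l → B≈B′ l j) i

  ·-congˡ : ∀ {k} (A : Mat k) {B B′ : Mat k} → B ≈M B′ → (A · B) ≈M (A · B′)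
  ·-congˡ A = ·-cong {A = A} (λ i j → refl)

  ·-congʳ : ∀ {k} (B : Mat k) {A A′ : Mat k} → A ≈M A′ → (A · B) ≈M (A′ · B)
  ·-congʳ B A≈A′ = ·-cong {B = B} A≈A′ (λ i j → refl)

  ·-assoc : ∀ {k} (A B C : Mat k) → ((A · B) · C) ≈M (A · (B · C))
  ·-assoc A B C i j = ·ᵥ-assoc A B (λ l → C l j) i

  ·-identityˡ : ∀ {k} (A : Mat k) → (idM · A) ≈M A
  ·-identityˡ A i j = ·ᵥ-identityˡ (λ l → A l j) i

  ·-identityʳ : ∀ {k} (A : Mat k) → (A · idM) ≈M A
  ·-identityʳ A i j = sum-*-idM (A i) j

  lastCol : ∀ {n} → Mat (suc n) → Vector Carrier n
  lastCol {n} X i = X (inject₁ i) (fromℕ n)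

  lastRow : ∀ {n} → Mat (suc n) → Vector Carrier n
  lastRow {n} X j = X (fromℕ n) (inject₁ j)

  corner : ∀ {n} → Mat (suc n) → Carrier
  corner {n} X = X (fromℕ n) (fromℕ n)

  block : ∀ {n} → Mat n → Vector Carrier n → Carrier → Mat (suc n)
  block A c d i j with inner? i | inner? j
  ... | just i′ | just j′ = A i′ j′
  ... | just i′ | nothing = c i′
  ... | nothing | just _  = 0#
  ... | nothing | nothing = d

  inner?-inject₁ : ∀ {n} (i : Fin n) → inner? (inject₁ i) ≡ just i
  inner?-inject₁ {suc n} zero = ≡.refl
  inner?-inject₁ {suc n} (suc i) rewrite inner?-inject₁ i = ≡.refl

  inner?-fromℕ : ∀ n → inner? (fromℕ n) ≡ nothing
  inner?-fromℕ ℕ.zero = ≡.refl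
  inner?-fromℕ (suc n) rewrite inner?-fromℕ n = ≡.refl

  parent-block : ∀ {n} (A : Mat n) c d → parent (block A c d) ≈M A
  parent-block A c d i j rewrite inner?-inject₁ i | inner?-inject₁ j = refl

  lastCol-block : ∀ {n} (A : Mat n) c d → lastCol (block A c d) ≋ c
  lastCol-block {n} A c d i rewrite inner?-inject₁ i | inner?-fromℕ n = refl

  lastRow-block : ∀ {n} (A : Mat n) c d → lastRow (block A c d) ≋ 0ᵥ
  lastRow-block {n} A c d j rewrite inner?-inject₁ j | inner?-fromℕ n = refl

  corner-block : ∀ {n} (A : Mat n) c d → corner (block A c d) ≈ d
  corner-block {n} A c d rewrite inner?-fromℕ n = refl

  block-cong : ∀ {n} {A A′ : Mat n} {c c′ d d′} → A ≈M A′ → c ≋ c′ → d ≈ d′ →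
    block A c d ≈M block A′ c′ d′
  block-cong A≈A′ c≋c′ d≈d′ i j with inner? i | inner? j
  ... | just i′ | just j′ = A≈A′ i′ j′
  ... | just i′ | nothing = c≋c′ i′
  ... | nothing | just _  = refl
  ... | nothing | nothing = d≈d′

  extend-block : ∀ {n} (N : Mat n) b → extend N b ≈M block N b 0#
  extend-block N b i j with inner? i | inner? j
  ... | just i′ | just j′ = refl
  ... | just i′ | nothing = refl
  ... | nothing | just _  = refl
  ... | nothing | nothing = refl

  bang-block : ∀ {n} b k → bang {n} b k ≈M block idM b k
  bang-block b k i j with inner? i | inner? j
  ... | just i′ | just j′ = refl
  ... | just i′ | nothing = refl
  ... | nothing | just _  = refl
  ... | nothing | nothing = refl

  ≈M-by-blocks : ∀ {n} {X Y : Mat (suc n)} → parent X ≈M parent Y → lastCol X ≋ lastCol Y →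
    lastRow X ≋ lastRow Y → corner X ≈ corner Y → X ≈M Y
  ≈M-by-blocks p c r d i j with view i | view j
  ... | ‵inject₁ i′ | ‵inject₁ j′ = p i′ j′
  ... | ‵inject₁ i′ | ‵fromℕ     = c i′
  ... | ‵fromℕ     | ‵inject₁ j′ = r j′
  ... | ‵fromℕ     | ‵fromℕ     = d

  block-η : ∀ {n} {X : Mat (suc n)} → lastRow X ≋ 0ᵥ → X ≈M block (parent X) (lastCol X) (corner X)
  block-η {X = X} r = ≈M-by-blocks
    (≈M.sym (parent-block (parent X) (lastCol X) (corner X)))
    (≋-sym (lastCol-block (parent X) (lastCol X) (corner X)))
    (≋-trans r (≋-sym (lastRow-block (parent X) (lastCol X) (corner X))))
    (sym (corner-block (parent X) (lastCol X) (corner X)))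

  x+a*0≈x : ∀ x a {b} → b ≈ 0# → x + a * b ≈ x
  x+a*0≈x x a b≈0 = trans (+-congˡ (trans (*-congˡ b≈0) (zeroʳ a))) (+-identityʳ x)

  x+0*b≈x : ∀ x b {a} → a ≈ 0# → x + a * b ≈ x
  x+0*b≈x x b a≈0 = trans (+-congˡ (trans (*-congʳ a≈0) (zeroˡ b))) (+-identityʳ x)

  0*b≈0 : ∀ {a} b → a ≈ 0# → a * b ≈ 0#
  0*b≈0 b a≈0 = trans (*-congʳ a≈0) (zeroˡ b)

  a*0≈0 : ∀ a {b} → b ≈ 0# → a * b ≈ 0#
  a*0≈0 a b≈0 = trans (*-congˡ b≈0) (zeroʳ a)

  parent-· : ∀ {n} (X Y : Mat (suc n)) → lastRow Y ≋ 0ᵥ → parent (X · Y) ≈M (parent X · parent Y)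
  parent-· {n} X Y r i j = trans (sumFin-init-last (λ l → X (inject₁ i) l * Y l (inject₁ j)))
    (x+a*0≈x _ (lastCol X i) (r j))

  lastCol-· : ∀ {n} (X Y : Mat (suc n)) i →
    lastCol (X · Y) i ≈ (parent X ·ᵥ lastCol Y) i + lastCol X i * corner Y
  lastCol-· {n} X Y i = sumFin-init-last (λ l → X (inject₁ i) l * Y l (fromℕ n))

  lastRow-· : ∀ {n} (X Y : Mat (suc n)) → lastRow X ≋ 0ᵥ → ∀ j →
    lastRow (X · Y) j ≈ corner X * lastRow Y j
  lastRow-· {n} X Y r j = trans (sumFin-init-last (λ l → X (fromℕ n) l * Y l (inject₁ j)))
    (trans (+-congʳ (sumFin-zero {n} (λ l → 0*b≈0 _ (r l)))) (+-identityˡ _))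

  corner-· : ∀ {n} (X Y : Mat (suc n)) → lastRow X ≋ 0ᵥ → corner (X · Y) ≈ corner X * corner Y
  corner-· {n} X Y r = trans (sumFin-init-last (λ l → X (fromℕ n) l * Y l (fromℕ n)))
    (trans (+-congʳ (sumFin-zero {n} (λ l → 0*b≈0 _ (r l)))) (+-identityˡ _))

  block-· : ∀ {n} (A A′ : Mat n) c c′ d d′ →
    (block A c d · block A′ c′ d′) ≈M block (A · A′) (λ i → (A ·ᵥ c′) i + c i * d′) (d * d′)
  block-· A A′ c c′ d d′ = ≈M.trans (block-η lastRow-XY) (block-cong
    (λ i j → trans (parent-· X Y (lastRow-block A′ c′ d′) i j)
                   (·-cong (parent-block A c d) (parent-block A′ c′ d′) i j))
    (λ i → trans (lastCol-· X Y i)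
      (+-cong (·ᵥ-cong (parent-block A c d) (lastCol-block A′ c′ d′) i)
              (*-cong (lastCol-block A c d i) (corner-block A′ c′ d′))))
    (trans (corner-· X Y (lastRow-block A c d)) (*-cong (corner-block A c d) (corner-block A′ c′ d′))))
    where
    X = block A c d
    Y = block A′ c′ d′
    lastRow-XY : lastRow (X · Y) ≋ 0ᵥ
    lastRow-XY j = trans (lastRow-· X Y (lastRow-block A c d) j) (a*0≈0 _ (lastRow-block A′ c′ d′ j))

  parent-idM : ∀ {n} → parent (idM {suc n}) ≈M idM
  parent-idM {suc n} zero    zero    = refl
  parent-idM {suc n} zero    (suc j) = refl
  parent-idM {suc n} (suc i) zero    = refl
  parent-idM {suc n} (suc i) (suc j) = parent-idM i j

  lastCol-idM : ∀ {n} → lastCol (idM {suc n}) ≋ 0ᵥ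
  lastCol-idM {suc n} zero    = refl
  lastCol-idM {suc n} (suc i) = lastCol-idM i

  lastRow-idM : ∀ {n} → lastRow (idM {suc n}) ≋ 0ᵥ
  lastRow-idM {suc n} zero    = refl
  lastRow-idM {suc n} (suc j) = lastRow-idM j

  corner-idM : ∀ n → corner (idM {suc n}) ≈ 1#
  corner-idM ℕ.zero  = refl
  corner-idM (suc n) = corner-idM n

  idM-block : ∀ {n} → idM {suc n} ≈M block idM 0ᵥ 1#
  idM-block {n} = ≈M.trans (block-η lastRow-idM) (block-cong parent-idM lastCol-idM (corner-idM n))

  UT-resp-≈M : ∀ {k} {A B : Mat k} → A ≈M B → UpperTriangular A → UpperTriangular B
  UT-resp-≈M A≈B uA i j j<i = trans (sym (A≈B i j)) (uA i j j<i)

  parent-UT : ∀ {n} {X : Mat (suc n)} → UpperTriangular X → UpperTriangular (parent X)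
  parent-UT uX i j j<i = uX (inject₁ i) (inject₁ j)
    (≡.subst₂ ℕ._<_ (≡.sym (toℕ-inject₁ j)) (≡.sym (toℕ-inject₁ i)) j<i)

  lastRow-UT : ∀ {n} {X : Mat (suc n)} → UpperTriangular X → lastRow X ≋ 0ᵥ
  lastRow-UT {n} uX j = uX (fromℕ n) (inject₁ j)
    (≡.subst₂ ℕ._<_ (≡.sym (toℕ-inject₁ j)) (≡.sym (toℕ-fromℕ n)) (toℕ<n j))

  UT-by-blocks : ∀ {n} {X : Mat (suc n)} → UpperTriangular (parent X) → lastRow X ≋ 0ᵥ → UpperTriangular X
  UT-by-blocks {n} uP r i j j<i with view i | view j
  ... | ‵inject₁ i′ | ‵inject₁ j′ = uP i′ j′ (≡.subst₂ ℕ._<_ (toℕ-inject₁ j′) (toℕ-inject₁ i′) j<i)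
  ... | ‵inject₁ i′ | ‵fromℕ     =
    ⊥-elim (<-asym (≡.subst₂ ℕ._<_ (toℕ-fromℕ n) (toℕ-inject₁ i′) j<i) (toℕ<n i′))
  ... | ‵fromℕ     | ‵inject₁ j′ = r j′
  ... | ‵fromℕ     | ‵fromℕ     = ⊥-elim (<-irrefl ≡.refl j<i)

  block-UT : ∀ {n} {A : Mat n} {c d} → UpperTriangular A → UpperTriangular (block A c d)
  block-UT {A = A} {c} {d} uA =
    UT-by-blocks (UT-resp-≈M (≈M.sym (parent-block A c d)) uA) (lastRow-block A c d)

  ·-UT : ∀ {k} {A B : Mat k} → UpperTriangular A → UpperTriangular B → UpperTriangular (A · B)
  ·-UT {k} {A} {B} uA uB i j j<i = sumFin-zero {k} term≈0
    where
    term≈0 : ∀ l → A i l * B l j ≈ 0#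
    term≈0 l with toℕ l ℕ.<? toℕ i
    ... | yes l<i = 0*b≈0 (B l j) (uA i l l<i)
    ... | no  l≮i = a*0≈0 (A i l) (uB l j (<-≤-trans j<i (≮⇒≥ l≮i)))

  lastRow-rightInverse : ∀ {n} {G G′ : Mat (suc n)} → UpperTriangular G → (G · G′) ≈M idM →
    lastRow G′ ≋ 0ᵥ
  lastRow-rightInverse {n} {G} {G′} uG GG′≈I j = begin
    lastRow G′ j                             ≈⟨ *-identityˡ _ ⟨
    1# * lastRow G′ j                        ≈⟨ *-congʳ corners-inverse ⟨
    (corner G′ * corner G) * lastRow G′ j    ≈⟨ *-assoc _ _ _ ⟩
    corner G′ * (corner G * lastRow G′ j)    ≈⟨ *-congˡ (lastRow-· G G′ (lastRow-UT uG) j) ⟨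
    corner G′ * lastRow (G · G′) j           ≈⟨ a*0≈0 _ (trans (GG′≈I _ _) (lastRow-idM j)) ⟩
    0#                                       ∎
    where
    open ≈-Reasoning
    corners-inverse : corner G′ * corner G ≈ 1#
    corners-inverse = trans (*-comm _ _)
      (trans (sym (corner-· G G′ (lastRow-UT uG))) (trans (GG′≈I _ _) (corner-idM n)))

  parent-inverse : ∀ {n} {G G′ : Mat (suc n)} → UpperTriangular G → IsInverse G G′ →
    IsInverse (parent G) (parent G′)
  parent-inverse {G = G} {G′} uG (GG′≈I , G′G≈I) =
    (λ i j → trans (sym (parent-· G G′ (lastRow-rightInverse {G = G} {G′} uG GG′≈I) i j))
                   (trans (GG′≈I _ _) (parent-idM i j))) ,
    (λ i j → trans (sym (parent-· G′ G (lastRow-UT uG) i j)) (trans (G′G≈I _ _) (parent-idM i j)))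

  UT-inverse : ∀ {k} {G G′ : Mat k} → UpperTriangular G → IsInverse G G′ → UpperTriangular G′
  UT-inverse {ℕ.zero} _ _ ()
  UT-inverse {suc n} {G} {G′} uG inv@(GG′≈I , _) = UT-by-blocks {X = G′}
    (UT-inverse {G = parent G} (parent-UT {X = G} uG) (parent-inverse {G = G} {G′} uG inv))
    (lastRow-rightInverse {G = G} {G′} uG GG′≈I)

  ·-rightInverse : ∀ {k} {A A′ B B′ : Mat k} → (A · A′) ≈M idM → (B · B′) ≈M idM →
    ((A · B) · (B′ · A′)) ≈M idM
  ·-rightInverse {A = A} {A′} {B} {B′} AA′≈I BB′≈I = begin
    (A · B) · (B′ · A′)  ≈⟨ ·-assoc A B (B′ · A′) ⟩
    A · (B · (B′ · A′))  ≈⟨ ·-congˡ A (·-assoc B B′ A′) ⟨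
    A · ((B · B′) · A′)  ≈⟨ ·-congˡ A (·-congʳ A′ BB′≈I) ⟩
    A · (idM · A′)       ≈⟨ ·-congˡ A (·-identityˡ A′) ⟩
    A · A′               ≈⟨ AA′≈I ⟩
    idM                  ∎
    where open ≈M-Reasoning

  ·-inverse : ∀ {k} {A A′ B B′ : Mat k} → IsInverse A A′ → IsInverse B B′ → IsInverse (A · B) (B′ · A′)
  ·-inverse (AA′≈I , A′A≈I) (BB′≈I , B′B≈I) =
    ·-rightInverse AA′≈I BB′≈I , ·-rightInverse B′B≈I A′A≈I

  conj-inverse : ∀ {k} {B B′ X Y : Mat k} → IsInverse B B′ → ((B′ · X) · B) ≈M Y → ((B · Y) · B′) ≈M X
  conj-inverse {B = B} {B′} {X} {Y} (BB′≈I , _) conj = begin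
    (B · Y) · B′                ≈⟨ ·-congʳ B′ (·-congˡ B conj) ⟨
    (B · ((B′ · X) · B)) · B′   ≈⟨ ·-congʳ B′ (·-congˡ B (·-assoc B′ X B)) ⟩
    (B · (B′ · (X · B))) · B′   ≈⟨ ·-congʳ B′ (·-assoc B B′ (X · B)) ⟨
    ((B · B′) · (X · B)) · B′   ≈⟨ ·-congʳ B′ (·-congʳ (X · B) BB′≈I) ⟩
    (idM · (X · B)) · B′        ≈⟨ ·-congʳ B′ (·-identityˡ (X · B)) ⟩
    (X · B) · B′                ≈⟨ ·-assoc X B B′ ⟩
    X · (B · B′)                ≈⟨ ·-congˡ X BB′≈I ⟩
    X · idM                     ≈⟨ ·-identityʳ X ⟩
    X                           ∎
    where open ≈M-Reasoning

  ∼-sym : ∀ {k} {X Y : Mat k} → X ∼ Y → Y ∼ X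
  ∼-sym (B , B′ , uB , inv@(BB′≈I , B′B≈I) , conj) =
    B′ , B , UT-inverse uB inv , (B′B≈I , BB′≈I) , conj-inverse inv conj

  ∼-trans : ∀ {k} {X Y Z : Mat k} → X ∼ Y → Y ∼ Z → X ∼ Z
  ∼-trans {X = X} {Y} {Z} (B , B′ , uB , invB , conjB) (C , C′ , uC , invC , conjC) =
    B · C , C′ · B′ , ·-UT uB uC , ·-inverse invB invC , conj
    where
    open ≈M-Reasoning
    conj : (((C′ · B′) · X) · (B · C)) ≈M Z
    conj = begin
      ((C′ · B′) · X) · (B · C)  ≈⟨ ·-congʳ (B · C) (·-assoc C′ B′ X) ⟩
      (C′ · (B′ · X)) · (B · C)  ≈⟨ ·-assoc (C′ · (B′ · X)) B C ⟨
      ((C′ · (B′ · X)) · B) · C  ≈⟨ ·-congʳ C (·-assoc C′ (B′ · X) B) ⟩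
      (C′ · ((B′ · X) · B)) · C  ≈⟨ ·-congʳ C (·-congˡ C′ conjB) ⟩
      (C′ · Y) · C               ≈⟨ conjC ⟩
      Z                          ∎

  ∼-respʳ-≈M : ∀ {k} {X Y Y′ : Mat k} → X ∼ Y → Y ≈M Y′ → X ∼ Y′
  ∼-respʳ-≈M (B , B′ , uB , inv , conj) Y≈Y′ = B , B′ , uB , inv , ≈M.trans conj Y≈Y′

  UT-resp-∼ : ∀ {k} {X Y : Mat k} → X ∼ Y → UpperTriangular X → UpperTriangular Y
  UT-resp-∼ (B , B′ , uB , inv , conj) uX = UT-resp-≈M conj (·-UT (·-UT (UT-inverse uB inv) uX) uB)

  parent-resp-∼ : ∀ {n} {X Y : Mat (suc n)} → UpperTriangular X → X ∼ Y → parent X ∼ parent Y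
  parent-resp-∼ {X = X} {Y} uX (B , B′ , uB , inv , conj) =
    parent B , parent B′ , parent-UT {X = B} uB , parent-inverse {G = B} {B′} uB inv , parent-conj
    where
    parent-conj : ((parent B′ · parent X) · parent B) ≈M parent Y
    parent-conj = begin
      (parent B′ · parent X) · parent B  ≈⟨ ·-congʳ (parent B) (parent-· B′ X (lastRow-UT {X = X} uX)) ⟨
      parent (B′ · X) · parent B         ≈⟨ parent-· (B′ · X) B (lastRow-UT {X = B} uB) ⟨
      parent ((B′ · X) · B)              ≈⟨ (λ i j → conj (inject₁ i) (inject₁ j)) ⟩
      parent Y                           ∎
      where open ≈M-Reasoning

  extend-cong : ∀ {n} {N N′ : Mat n} {b b′} → N ≈M N′ → b ≋ b′ → extend N b ≈M extend N′ b′
  extend-cong {N = N} {N′} {b} {b′} N≈N′ b≋b′ =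
    ≈M.trans (extend-block N b) (≈M.trans (block-cong N≈N′ b≋b′ refl) (≈M.sym (extend-block N′ b′)))

  extend-injective : ∀ {n} {N N′ : Mat n} {b b′} → extend N b ≈M extend N′ b′ → N ≈M N′ × b ≋ b′
  extend-injective {N = N} {N′} {b} {b′} E≈E′ =
    (λ i j → trans (sym (parent-extend N b i j)) (trans (E≈E′ _ _) (parent-extend N′ b′ i j))) ,
    (λ i → trans (sym (lastCol-extend N b i)) (trans (E≈E′ _ _) (lastCol-extend N′ b′ i)))
    where
    parent-extend : ∀ N b → parent (extend N b) ≈M N
    parent-extend N b i j = trans (extend-block N b _ _) (parent-block N b 0# i j)
    lastCol-extend : ∀ N b → lastCol (extend N b) ≋ b
    lastCol-extend N b i = trans (extend-block N b _ _) (lastCol-block N b 0# i)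

  conj-extend : ∀ {n} (A′ : Mat n) h′ k′ N b (A : Mat n) h k →
    ((block A′ h′ k′ · extend N b) · block A h k) ≈M
      extend ((A′ · N) · A) (λ i → ((A′ · N) ·ᵥ h) i + (A′ ·ᵥ b) i * k)
  conj-extend A′ h′ k′ N b A h k = begin
    (block A′ h′ k′ · extend N b) · block A h k
      ≈⟨ ·-congʳ (block A h k) (·-congˡ (block A′ h′ k′) (extend-block N b)) ⟩
    (block A′ h′ k′ · block N b 0#) · block A h k
      ≈⟨ ·-congʳ (block A h k) (block-· A′ N h′ b k′ 0#) ⟩
    block (A′ · N) (λ i → (A′ ·ᵥ b) i + h′ i * 0#) (k′ * 0#) · block A h k
      ≈⟨ block-· (A′ · N) A _ h (k′ * 0#) k ⟩
    block ((A′ · N) · A) (λ i → ((A′ · N) ·ᵥ h) i + ((A′ ·ᵥ b) i + h′ i * 0#) * k) ((k′ * 0#) * k)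
      ≈⟨ block-cong ≈M.refl (λ i → +-congˡ (*-congʳ (x+a*0≈x _ (h′ i) refl)))
                             (0*b≈0 k (zeroʳ k′)) ⟩
    block ((A′ · N) · A) (λ i → ((A′ · N) ·ᵥ h) i + (A′ ·ᵥ b) i * k) 0#
      ≈⟨ extend-block _ _ ⟨
    extend ((A′ · N) · A) (λ i → ((A′ · N) ·ᵥ h) i + (A′ ·ᵥ b) i * k) ∎
    where open ≈M-Reasoning

  block-rightInverse : ∀ {n} {A A′ : Mat n} {c c′ d d′} → (A · A′) ≈M idM →
    (λ i → (A ·ᵥ c′) i + c i * d′) ≋ 0ᵥ → d * d′ ≈ 1# → (block A c d · block A′ c′ d′) ≈M idM
  block-rightInverse {A = A} {A′} {c} {c′} {d} {d′} AA′≈I col≈0 dd′≈1 =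
    ≈M.trans (block-· A A′ c c′ d d′) (≈M.trans (block-cong AA′≈I col≈0 dd′≈1) (≈M.sym idM-block))

  extend-zero-resp-∼ : ∀ {n} {P Q : Mat n} → P ∼ Q → extend P 0ᵥ ∼ extend Q 0ᵥ
  extend-zero-resp-∼ {P = P} (C , C′ , uC , (CC′≈I , C′C≈I) , conj) =
    block C 0ᵥ 1# , block C′ 0ᵥ 1# , block-UT uC ,
    (block-rightInverse CC′≈I (column≈0 C) (*-identityˡ 1#) ,
     block-rightInverse C′C≈I (column≈0 C′) (*-identityˡ 1#)) ,
    ≈M.trans (conj-extend C′ 0ᵥ 1# P 0ᵥ C 0ᵥ 1#)
      (extend-cong conj (λ i → trans (+-cong (·ᵥ-zeroʳ (C′ · P) i) (0*b≈0 1# (·ᵥ-zeroʳ C′ i)))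
                                     (+-identityʳ 0#)))
    where
    column≈0 : ∀ D → (λ i → (D ·ᵥ 0ᵥ) i + 0# * 1#) ≋ 0ᵥ
    column≈0 D i = trans (+-cong (·ᵥ-zeroʳ D i) (zeroˡ 1#)) (+-identityʳ 0#)

  extend-zero-∼⇒range : ∀ {n} {N : Mat n} {b} → extend N 0ᵥ ∼ extend N b →
    Σ (Vector Carrier n) λ x → b ≋ N ·ᵥ x
  extend-zero-∼⇒range {n} {N} {b} (H , H′ , uH , inv , conj) = A′ ·ᵥ h , b≋N·A′h
    where
    A = parent H
    A′ = parent H′
    h = lastCol H
    block-conj : extend ((A′ · N) · A) (λ i → ((A′ · N) ·ᵥ h) i + (A′ ·ᵥ 0ᵥ) i * corner H) ≈M extend N b
    block-conj = begin
      extend ((A′ · N) · A) (λ i → ((A′ · N) ·ᵥ h) i + (A′ ·ᵥ 0ᵥ) i * corner H)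
        ≈⟨ conj-extend A′ (lastCol H′) (corner H′) N 0ᵥ A h (corner H) ⟨
      (block A′ (lastCol H′) (corner H′) · extend N 0ᵥ) · block A h (corner H)
        ≈⟨ ·-cong (·-congʳ (extend N 0ᵥ) (block-η {X = H′} (lastRow-UT (UT-inverse {G = H} {H′} uH inv))))
                  (block-η {X = H} (lastRow-UT uH)) ⟨
      (H′ · extend N 0ᵥ) · H
        ≈⟨ conj ⟩
      extend N b ∎
      where open ≈M-Reasoning
    A′NA≈N : ((A′ · N) · A) ≈M N
    A′NA≈N = proj₁ (extend-injective block-conj)
    A′N≈NA′ : (A′ · N) ≈M (N · A′)
    A′N≈NA′ = begin
      A′ · N              ≈⟨ ·-identityʳ (A′ · N) ⟨
      (A′ · N) · idM      ≈⟨ ·-congˡ (A′ · N) (proj₁ (parent-inverse {G = H} {H′} uH inv)) ⟨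
      (A′ · N) · (A · A′) ≈⟨ ·-assoc (A′ · N) A A′ ⟨
      ((A′ · N) · A) · A′ ≈⟨ ·-congʳ A′ A′NA≈N ⟩
      N · A′              ∎
      where open ≈M-Reasoning
    b≋N·A′h : b ≋ N ·ᵥ (A′ ·ᵥ h)
    b≋N·A′h i = begin
      b i                                                   ≈⟨ proj₂ (extend-injective block-conj) i ⟨
      ((A′ · N) ·ᵥ h) i + (A′ ·ᵥ 0ᵥ) i * corner H           ≈⟨ x+0*b≈x _ (corner H) (·ᵥ-zeroʳ A′ i) ⟩
      ((A′ · N) ·ᵥ h) i                                     ≈⟨ ·ᵥ-cong A′N≈NA′ ≋-refl i ⟩
      ((N · A′) ·ᵥ h) i                                     ≈⟨ ·ᵥ-assoc N A′ h i ⟩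
      (N ·ᵥ (A′ ·ᵥ h)) i                                    ∎
      where open ≈-Reasoning

  bang-inverse : ∀ {n} (d : Vector Carrier n) → IsInverse (bang d 1#) (bang (λ i → - d i) 1#)
  bang-inverse d =
    ≈M.trans (·-cong (bang-block d 1#) (bang-block -d 1#))
      (block-rightInverse (·-identityˡ idM) (λ i → trans (+-cong (·ᵥ-identityˡ -d i) (*-identityʳ (d i)))
                                                       (-‿inverseˡ (d i))) (*-identityˡ 1#)) ,
    ≈M.trans (·-cong (bang-block -d 1#) (bang-block d 1#))
      (block-rightInverse (·-identityˡ idM) (λ i → trans (+-cong (·ᵥ-identityˡ d i) (*-identityʳ (- d i)))
                                                       (-‿inverseʳ (d i))) (*-identityˡ 1#))
    where
    -d : Vector Carrier _
    -d i = - d i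

  bang-conj-extend : ∀ {n} (N : Mat n) b d →
    ((bang (λ i → - d i) 1# · extend N b) · bang d 1#) ≈M extend N (λ i → (N ·ᵥ d) i + b i)
  bang-conj-extend N b d = begin
    (bang (λ i → - d i) 1# · extend N b) · bang d 1#
      ≈⟨ ·-cong (·-congʳ (extend N b) (bang-block _ 1#)) (bang-block d 1#) ⟩
    (block idM (λ i → - d i) 1# · extend N b) · block idM d 1#
      ≈⟨ conj-extend idM _ 1# N b idM d 1# ⟩
    extend ((idM · N) · idM) (λ i → ((idM · N) ·ᵥ d) i + (idM ·ᵥ b) i * 1#)
      ≈⟨ extend-cong (≈M.trans (·-identityʳ (idM · N)) (·-identityˡ N))
           (λ i → +-cong (·ᵥ-cong (·-identityˡ N) ≋-refl i) (trans (*-identityʳ _) (·ᵥ-identityˡ b i))) ⟩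
    extend N (λ i → (N ·ᵥ d) i + b i) ∎
    where open ≈M-Reasoning

  range⇒SameBangOrbit : ∀ {n} (N : Mat n) {b₁ b₂ x₁ x₂} → b₁ ≋ N ·ᵥ x₁ → b₂ ≋ N ·ᵥ x₂ →
    SameBangOrbit (extend N b₁) (extend N b₂)
  range⇒SameBangOrbit N {b₁} {b₂} {x₁} {x₂} b₁≋Nx₁ b₂≋Nx₂ =
    d , 1# , bang (λ i → - d i) 1# , (λ 1≈0 → 0≉1 (sym 1≈0)) , bang-inverse d ,
    ≈M.trans (bang-conj-extend N b₁ d) (extend-cong ≈M.refl Nd+b₁≋b₂)
    where
    d : Vector Carrier _
    d i = x₂ i - x₁ i
    d+x₁≋x₂ : (λ i → d i + x₁ i) ≋ x₂
    d+x₁≋x₂ i = trans (+-assoc (x₂ i) (- x₁ i) (x₁ i))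
      (trans (+-congˡ (-‿inverseˡ (x₁ i))) (+-identityʳ (x₂ i)))
    Nd+b₁≋b₂ : (λ i → (N ·ᵥ d) i + b₁ i) ≋ b₂
    Nd+b₁≋b₂ i = begin
      (N ·ᵥ d) i + b₁ i             ≈⟨ +-congˡ (b₁≋Nx₁ i) ⟩
      (N ·ᵥ d) i + (N ·ᵥ x₁) i      ≈⟨ ·ᵥ-distrib-+ N d x₁ i ⟨
      (N ·ᵥ (λ l → d l + x₁ l)) i   ≈⟨ ·ᵥ-cong {A = N} ≈M.refl d+x₁≋x₂ i ⟩
      (N ·ᵥ x₂) i                   ≈⟨ b₂≋Nx₂ i ⟨
      b₂ i                          ∎
      where open ≈-Reasoning

  lastColumn-zero⇒extend : ∀ {n} {M : Mat (suc n)} → UpperTriangular M → (∀ i → M i (fromℕ n) ≈ 0#) →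
    M ≈M extend (parent M) 0ᵥ
  lastColumn-zero⇒extend {n} {M} uM lastColumn≈0 =
    ≈M.trans (block-η (lastRow-UT {X = M} uM))
      (≈M.trans (block-cong ≈M.refl (λ i → lastColumn≈0 (inject₁ i)) (lastColumn≈0 (fromℕ n)))
        (≈M.sym (extend-block (parent M) 0ᵥ)))

  trivially-extended⇒zero∈B : ∀ {n} {N′ : Mat (suc n)} {N : Mat n} → UpperTriangular N′ →
    TriviallyExtended N′ → parent N′ ∼ N → InB N N′ 0ᵥ
  trivially-extended⇒zero∈B {N′ = N′} {N} uN′ (M , M∼N′ , lastColumn≈0) parentN′∼N =
    ∼-trans {X = extend N 0ᵥ} {Y = M}
      (∼-respʳ-≈M {X = extend N 0ᵥ} (extend-zero-resp-∼ N∼parentM) (≈M.sym M≈extend)) M∼N′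
    where
    N′∼M : N′ ∼ M
    N′∼M = ∼-sym {X = M} M∼N′
    M≈extend : M ≈M extend (parent M) 0ᵥ
    M≈extend = lastColumn-zero⇒extend (UT-resp-∼ {X = N′} N′∼M uN′) lastColumn≈0
    N∼parentM : N ∼ parent M
    N∼parentM =
      ∼-trans {Y = parent N′} (∼-sym {X = parent N′} parentN′∼N) (parent-resp-∼ {X = N′} uN′ N′∼M)

  zero∈B⇒SameBangOrbit : ∀ {n} {N : Mat n} {N′ : Mat (suc n)} {b₁ b₂} → InB N N′ 0ᵥ →
    InB N N′ b₁ → InB N N′ b₂ → SameBangOrbit (extend N b₁) (extend N b₂)
  zero∈B⇒SameBangOrbit {n} {N} {N′} zero∈B b₁∈B b₂∈B =
    range⇒SameBangOrbit N (proj₂ (range b₁∈B)) (proj₂ (range b₂∈B))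
    where
    range : ∀ {b} → InB N N′ b → Σ (Vector Carrier n) λ x → b ≋ N ·ᵥ x
    range {b} b∈B =
      extend-zero-∼⇒range (∼-trans {X = extend N 0ᵥ} {Y = N′} zero∈B (∼-sym {X = extend N b} b∈B))

proposition2p4 : ∀ {c ℓ : Level} (F : FiniteField c ℓ) → let open Matrices F in
    (n : ℕ) → n ≥ 1 → (N′ : Mat (suc n)) → UNil N′ → TriviallyExtended N′ →
    (N : Mat n) → UNil N → parent N′ ∼ N → MatrixDegreeOne N N′
proposition2p4 F n _ N′ (uN′ , _) trivially-extended N _ parentN′∼N =
  (0ᵥ , zero∈B) , λ b₁ b₂ → zero∈B⇒SameBangOrbit zero∈B
  where
  open Matrices F
  open MatrixDegree F
  zero∈B : InB N N′ 0ᵥ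
  zero∈B = trivially-extended⇒zero∈B uN′ trivially-extended parentN′∼N
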